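{- Let $G$ be a Nim sequence over an additively periodic sequence $(\mathcal{Y}_x)_{x\in\mathbb{N}}$ of finite subsets of $\mathbb{Z}$. Then $G:\mathbb{N}\to\mathbb{N}$ is a bijection.
   Context: $\mathbb{N}=\{0,1,2,\dots\}$. For a finite $Y\subseteq\mathbb{Z}$, $\operatorname{mex}(Y)=\min(\mathbb{N}\setminus Y)$. $(\mathcal{Y}_x)$ is additively periodic if there is $p\ge1$ with $\mathcal{Y}_{x+p}=\mathcal{Y}_x+p$ for all $x\in\mathbb{N}$. A Nim sequence over $(\mathcal{Y}_x)$ with seed $[g_0,\dots,g_{L-1}]$ ($L\in\mathbb{N}$, $g_i\in\mathbb{N}$ pairwise distinct) is $G:\mathbb{N}\to\mathbb{N}$ with $G(x)=g_x$ for $x<L$ and $G(x)=\operatorname{mex}(\{G(x'):x'<x\}\cup\mathcal{Y}_x)$ for $x\ge L$. -}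

module Defs where

open import Data.Nat using (ℕ; _+_; _<_; _≤_)
open import Data.Integer as ℤ using (ℤ; +_)
open import Data.List using (List; length; lookup)
open import Data.List.Membership.Propositional using (_∈_)
open import Data.List.Relation.Unary.Unique.Propositional using (Unique)
open import Data.Fin using (fromℕ<)
open import Data.Product using (Σ; _×_; ∃)
open import Relation.Nullary using (¬_)
open import Relation.Binary.PropositionalEquality using (_≡_)
open import Function.Bundles using (_⇔_)

FinSubsetSeq : Set
FinSubsetSeq = ℕ → List ℤ

_≈ₛ_ : List ℤ → List ℤ → Set
A ≈ₛ B = ∀ z → (z ∈ A) ⇔ (z ∈ B)

shift : ℤ → List ℤ → List ℤ
shift p A = Data.List.map (λ z → z ℤ.+ p) A
  where import Data.List

AdditivelyPeriodic : FinSubsetSeq → Set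
AdditivelyPeriodic Y = Σ ℕ λ p → (1 ≤ p) × (∀ x → Y (x + p) ≈ₛ shift (+ p) (Y x))

IsMex : (ℤ → Set) → ℕ → Set
IsMex S m = ¬ S (+ m) × (∀ k → k < m → S (+ k))

MexSet : FinSubsetSeq → (ℕ → ℕ) → ℕ → ℤ → Set
MexSet Y G x z = (Σ ℕ λ x' → (x' < x) × (+ (G x') ≡ z)) Data.Sum.⊎ (z ∈ Y x)
  where import Data.Sum

IsNimSequence : FinSubsetSeq → List ℕ → (ℕ → ℕ) → Set
IsNimSequence Y g G =
  Unique g
  × (∀ x → (x<L : x < length g) → G x ≡ lookup g (fromℕ< x<L))
  × (∀ x → length g ≤ x → IsMex (MexSet Y G x) (G x))

-- Injectivity holds for any Nim sequence: a seed value is never repeated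
-- inside the seed, and from L on G x avoids every earlier value by the mex rule.
-- For surjectivity, periodicity gives min 𝒴_{L + jp} ≥ min 𝒴_L + jp, so a fixed n
-- is absent from 𝒴_{L + jp} for all large j. If n were not yet taken by the time
-- n + 1 such positions have passed, the mex rule would put n + 1 distinct values
-- of G below n.
module Submission where

open import Defs
open import Data.Nat using (ℕ; zero; suc; _+_; _*_; _∸_; _<_; _≤_; s≤s; NonZero; >-nonZero; _≟_; _≤?_)
open import Data.Nat.Properties
open import Data.Integer as ℤ using (ℤ; +_; -[1+_]; ∣_∣)
import Data.Integer.Properties as ℤ
open import Data.List using (List; _∷_; length; lookup)
open import Data.List.Membership.Propositional using (_∈_; _∉_)
open import Data.List.Membership.Propositional.Properties using (∈-map⁻; ∈-lookup)
open import Data.List.Extrema ℤ.≤-totalOrder using (min; min≤xs)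
open import Data.List.Relation.Unary.All as All using ()
open import Data.List.Relation.Unary.AllPairs using (_∷_)
open import Data.List.Relation.Unary.Unique.Propositional using (Unique)
open import Data.Fin as Fin using (fromℕ<; toℕ)
import Data.Fin.Properties as Fin
open import Data.Product using (∃-syntax; _×_; _,_; proj₁; proj₂)
open import Data.Sum using (inj₁; inj₂)
open import Data.Empty using (⊥-elim)
open import Relation.Nullary using (¬_; Dec; yes; no; contradiction)
open import Relation.Binary using (tri<; tri≈; tri>)
open import Relation.Binary.PropositionalEquality using (_≡_; _≢_; refl; sym; trans; cong; subst)
open import Function.Definitions using (Bijective; Injective; Surjective)
open import Function.Bundles using (Equivalence)

lookup-injective : ∀ {a} {A : Set a} {xs : List A} → Unique xs →
                   ∀ i j → lookup xs i ≡ lookup xs j → i ≡ j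
lookup-injective (_ ∷ _)     Fin.zero    Fin.zero    _ = refl
lookup-injective (x≢ ∷ _)    Fin.zero    (Fin.suc j) e = contradiction e (All.lookup x≢ (∈-lookup j))
lookup-injective (x≢ ∷ _)    (Fin.suc i) Fin.zero    e = contradiction (sym e) (All.lookup x≢ (∈-lookup i))
lookup-injective (_ ∷ uniq) (Fin.suc i) (Fin.suc j) e = cong Fin.suc (lookup-injective uniq i j e)

pigeonhole-ℕ : ∀ {f : ℕ → ℕ} → Injective _≡_ _≡_ f → ∀ n → ¬ (∀ k → k ≤ n → f k < n)
pigeonhole-ℕ {f} f-injective n f<n
  with i , j , i<j , fi≡fj ← Fin.pigeonhole (n<1+n n) (λ k → fromℕ< (f<n (toℕ k) (Fin.toℕ≤pred[n] k)))
  = <-irrefl (f-injective (Fin.fromℕ<-injective _ _ _ _ fi≡fj)) i<j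

∣i∣+n<m⇒+n<i+m : ∀ i {m n} → ∣ i ∣ + suc n ≤ m → + n ℤ.< i ℤ.+ + m
∣i∣+n<m⇒+n<i+m (+ a) {m} {n} h = ℤ.+<+ (≤-trans (m≤n+m (suc n) a) (≤-trans h (m≤n+m m a)))
∣i∣+n<m⇒+n<i+m -[1+ a ] {m} {n} h =
  subst (+ n ℤ.<_) (sym (ℤ.⊖-≥ (≤-trans (m≤m+n (suc a) (suc n)) h)))
    (ℤ.+<+ (subst (_≤ m ∸ suc a) (m+n∸m≡n (suc a) (suc n)) (∸-monoˡ-≤ (suc a) h)))

module _ {Y : FinSubsetSeq} {p : ℕ} (periodic : ∀ x → Y (x + p) ≈ₛ shift (+ p) (Y x)) where

  private
    +[1+j]*p-assoc : ∀ x j → x + suc j * p ≡ x + j * p + p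
    +[1+j]*p-assoc x j = trans (cong (λ k → x + k) (+-comm p (j * p))) (sym (+-assoc x (j * p) p))

  ∈-progression⁻ : ∀ x j {z} → z ∈ Y (x + j * p) → ∃[ w ] w ∈ Y x × z ≡ w ℤ.+ + (j * p)
  ∈-progression⁻ x zero {z} z∈ = z , subst (λ y → z ∈ Y y) (+-identityʳ x) z∈ , sym (ℤ.+-identityʳ z)
  ∈-progression⁻ x (suc j) {z} z∈
    with u , u∈ , refl ← ∈-map⁻ _ (Equivalence.to (periodic (x + j * p) z) (subst (λ y → z ∈ Y y) (+[1+j]*p-assoc x j) z∈))
    with w , w∈ , refl ← ∈-progression⁻ x j u∈
    = w , w∈ , trans (ℤ.+-assoc w (+ (j * p)) (+ p)) (cong (λ k → w ℤ.+ + k) (+-comm (j * p) p))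

  progression-eventually-avoids : .{{NonZero p}} → ∀ x n → ∃[ J ] ∀ j → J ≤ j → + n ∉ Y (x + j * p)
  progression-eventually-avoids x n = ∣ m ∣ + suc n , avoids
    where
      m : ℤ
      m = min (+ 0) (Y x)
      avoids : ∀ j → ∣ m ∣ + suc n ≤ j → + n ∉ Y (x + j * p)
      avoids j J≤j n∈ with w , w∈ , n≡w+jp ← ∈-progression⁻ x j n∈ =
        ℤ.<-irrefl n≡w+jp
          (ℤ.<-≤-trans (∣i∣+n<m⇒+n<i+m m (≤-trans J≤j (m≤m*n j p)))
                       (ℤ.+-monoˡ-≤ (+ (j * p)) (All.lookup (min≤xs (+ 0) (Y x)) w∈)))

module _ {Y : FinSubsetSeq} {g : List ℕ} {G : ℕ → ℕ} (nim : IsNimSequence Y g G) where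
  private
    L : ℕ
    L = length g

    seed : ∀ x (x<L : x < L) → G x ≡ lookup g (fromℕ< x<L)
    seed = proj₁ (proj₂ nim)

    mex : ∀ x → L ≤ x → IsMex (MexSet Y G x) (G x)
    mex = proj₂ (proj₂ nim)

  nim-≢-earlier : ∀ {x y} → x < y → G x ≢ G y
  nim-≢-earlier {x} {y} x<y Gx≡Gy with L ≤? y
  ... | yes L≤y = proj₁ (mex y L≤y) (inj₁ (x , x<y , cong +_ Gx≡Gy))
  ... | no L≰y = <⇒≢ x<y (Fin.fromℕ<-injective x y x<L y<L
                   (lookup-injective (proj₁ nim) _ _ (trans (sym (seed x x<L)) (trans Gx≡Gy (seed y y<L)))))
    where
      y<L : y < L
      y<L = ≰⇒> L≰y
      x<L : x < L
      x<L = <-trans x<y y<L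

  nim-injective : Injective _≡_ _≡_ G
  nim-injective {x} {y} Gx≡Gy with <-cmp x y
  ... | tri< x<y _ _ = contradiction Gx≡Gy (nim-≢-earlier x<y)
  ... | tri≈ _ x≡y _ = x≡y
  ... | tri> _ _ y<x = contradiction (sym Gx≡Gy) (nim-≢-earlier y<x)

  nim-≤-fresh : ∀ {x n} → length g ≤ x → + n ∉ Y x → (∀ {x′} → x′ < x → G x′ ≢ n) → G x ≤ n
  nim-≤-fresh {x} {n} L≤x n∉Yx fresh = ≮⇒≥ n≮Gx
    where
      n≮Gx : ¬ n < G x
      n≮Gx n<Gx with proj₂ (mex x L≤x) n n<Gx
      ... | inj₁ (x′ , x′<x , Gx′≡n) = fresh x′<x (ℤ.+-injective Gx′≡n)
      ... | inj₂ n∈Yx = n∉Yx n∈Yx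

  nim-surjective : ∀ p .{{_ : NonZero p}} →
                   (∀ n → ∃[ J ] ∀ j → J ≤ j → + n ∉ Y (length g + j * p)) → Surjective _≡_ _≡_ G
  nim-surjective p avoids n = search (anyUpTo? (λ x → G x ≟ n) (pos (suc n)))
    where
      J : ℕ
      J = proj₁ (avoids n)

      pos : ℕ → ℕ
      pos k = L + (J + k) * p

      pos-< : ∀ {k l} → k < l → pos k < pos l
      pos-< k<l = +-monoʳ-< L (*-monoˡ-< p (+-monoʳ-< J k<l))

      pos-injective : Injective _≡_ _≡_ pos
      pos-injective e = +-cancelˡ-≡ J _ _ (*-cancelʳ-≡ _ _ p (+-cancelˡ-≡ L _ _ e))

      search : Dec (∃[ x ] x < pos (suc n) × G x ≡ n) → ∃[ x ] ∀ {z} → z ≡ x → G z ≡ n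
      search (yes (x , _ , Gx≡n)) = x , λ { refl → Gx≡n }
      search (no n-not-taken) = ⊥-elim (pigeonhole-ℕ (λ e → pos-injective (nim-injective e)) n G∘pos<n)
        where
          G∘pos<n : ∀ k → k ≤ n → G (pos k) < n
          G∘pos<n k k≤n = ≤∧≢⇒< (nim-≤-fresh (m≤m+n L _) (proj₂ (avoids n) (J + k) (m≤m+n J k)) fresh)
                                (λ Gpos≡n → n-not-taken (pos k , pos-< (s≤s k≤n) , Gpos≡n))
            where
              fresh : ∀ {x′} → x′ < pos k → G x′ ≢ n
              fresh x′<pos Gx′≡n = n-not-taken (_ , <-trans x′<pos (pos-< (s≤s k≤n)) , Gx′≡n)

lemmal : (Y : FinSubsetSeq) → AdditivelyPeriodic Y → (g : List ℕ) → (G : ℕ → ℕ) → IsNimSequence Y g G → Bijective _≡_ _≡_ G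
lemmal Y (p , 1≤p , periodic) g G nim =
  nim-injective nim , nim-surjective nim p (progression-eventually-avoids periodic (length g))
  where
    instance
      p≢0 : NonZero p
      p≢0 = >-nonZero 1≤p
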